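{- There exists a canonical routing labeling scheme (in the designer-port model) for the family of rooted trees on $n$ nodes of bounded degree (every node has at most $\Delta$ children, for a constant $\Delta$) with labels of length $\log n + \mathcal{O}(\log\log n)$ bits.
   Context: Trees are rooted; $\mathsf{deg}(u)$ denotes the number of children of node $u$, and $T_u$ is the subtree rooted at $u$, with $|T_u|$ its number of nodes. A routing labeling scheme (designer-port model) for a family $\mathcal{T}$ of rooted trees consists of an encoder and a decoder. The encoder takes $T\in\mathcal{T}$, assigns a binary string (label) $\ell(u)$ to every node $u$, and labels every edge from a node $u$ to one of its children with a distinct port number from $\{1,\ldots,\mathsf{deg}(u)\}$ (chosen by the encoder). The decoder receives only $\ell(u)$ and $\ell(w)$ for two distinct nodes $u,w$ of some $T\in\mathcal{T}$ (and no other information about $T$, except that $\lceil\log n\rceil$ may be assumed known); it must return $0$ if the next node on the path from $u$ to $w$ is the parent of $u$, and otherwise the port number of the first edge on the path from $u$ to $w$. The length of the scheme is the maximum label length. The port assignment is canonical if for every node $v$ with children $v_1,\ldots,v_i$ ordered so that $|T_{v_1}|\ge\cdots\ge|T_{v_i}|$ (ties broken arbitrarily), the edge from $v$ to $v_j$ gets port $j$. Logarithms are base 2; the constant in $\mathcal{O}$ may depend on the degree bound $\Delta$. -}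

module Defs where

open import Data.Nat using (ℕ; zero; suc; _+_; _*_; _≤_; _<_; _≥_)
open import Data.Nat.Logarithm using (⌈log₂_⌉)
open import Data.Fin using (Fin; zero; suc)
open import Data.Bool using (Bool)
open import Data.List using (List; length)
open import Data.Product using (Σ; Σ-syntax; _×_)
open import Data.Empty using (⊥)
open import Relation.Nullary using (¬_)
open import Relation.Binary.PropositionalEquality using (_≡_)
open import Function.Definitions using (Injective)

-- Rooted trees: a node with k children, given by a function Fin k → Tree.
-- The indexing of the children is only an internal enumeration; the port
-- numbers are chosen separately by the encoder.
data Tree : Set where
  node : (k : ℕ) → (Fin k → Tree) → Tree

deg : Tree → ℕ
deg (node k _) = k

kid : (t : Tree) → Fin (deg t) → Tree
kid (node k f) i = f i

sumFin : (k : ℕ) → (Fin k → ℕ) → ℕ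
sumFin zero    g = 0
sumFin (suc k) g = g zero + sumFin k (λ i → g (suc i))

size : Tree → ℕ
size (node k f) = suc (sumFin k (λ i → size (f i)))

-- nodes of a tree, addressed by the path from the root
data Node : Tree → Set where
  root  : ∀ {t} → Node t
  child : ∀ {k f} (i : Fin k) → Node (f i) → Node (node k f)

sub : {t : Tree} → Node t → Tree
sub {t} root = t
sub (child i u) = sub u

MaxDeg : ℕ → Tree → Set
MaxDeg Δ t = (u : Node t) → deg (sub u) ≤ Δ

-- Via u i w : w lies in the subtree of the i-th child of u, i.e. the
-- first edge on the path from u to w is the edge from u to its i-th child.
data Via : {t : Tree} (u : Node t) → Fin (deg (sub u)) → Node t → Set where
  here  : ∀ {k} {f : Fin k → Tree} (i : Fin k) (w : Node (f i)) →
          Via {node k f} root i (child i w)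
  there : ∀ {k} {f : Fin k → Tree} (j : Fin k) {u : Node (f j)} {i : Fin (deg (sub u))} {w : Node (f j)} →
          Via u i w → Via {node k f} (child j u) i (child j w)

record Labeling (t : Tree) : Set where
  field
    label : Node t → List Bool
    port  : (u : Node t) → Fin (deg (sub u)) → ℕ

record Scheme : Set where
  field
    encode : (t : Tree) → Labeling t
    decode : List Bool → List Bool → ℕ

PortsValid : {t : Tree} → Labeling t → Set
PortsValid {t} L = (u : Node t) →
    ((i : Fin (deg (sub u))) → 1 ≤ port u i × port u i ≤ deg (sub u))
  × Injective _≡_ _≡_ (port u)
  where open Labeling L

-- Canonical: larger-numbered ports never lead to strictly larger subtrees,
-- i.e. ports 1..deg u enumerate the children by non-increasing |T_v|.
Canonical : {t : Tree} → Labeling t → Set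
Canonical {t} L = (u : Node t) (i j : Fin (deg (sub u))) →
    port u i < port u j → size (kid (sub u) i) ≥ size (kid (sub u) j)
  where open Labeling L

-- The decoder, given only the labels of distinct u, w, returns 0 if the
-- next hop from u towards w is the parent of u, and otherwise the port
-- of the first edge on the path from u to w.
Correct : (S : Scheme) (t : Tree) → Set
Correct S t =
    ((u w : Node t) (i : Fin (deg (sub u))) → Via u i w →
        decode (label u) (label w) ≡ port u i)
  × ((u w : Node t) → ¬ (u ≡ w) → ((i : Fin (deg (sub u))) → ¬ Via u i w) →
        decode (label u) (label w) ≡ 0)
  where
  open Scheme S
  open Labeling (encode t)

LabelsBounded : {t : Tree} → Labeling t → ℕ → Set
LabelsBounded {t} L b = (u : Node t) → length (Labeling.label L u) ≤ b

CanonicalRoutingScheme : ℕ → ℕ → Scheme → ℕ → Set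
CanonicalRoutingScheme Δ n S b = (t : Tree) → size t ≡ n → MaxDeg Δ t →
    PortsValid (Scheme.encode S t) × Canonical (Scheme.encode S t)
  × Correct S t × LabelsBounded (Scheme.encode S t) b

-- Positions: every subtree t receives an interval of span t ≥ |t| positions
-- starting at its root; after the root come the light children, each in a
-- block whose length is a float m·2^e (mantissa m ≤ A, hence O(log log n)
-- bits), and last the heaviest child.  The label of u is its position
-- (⌈log₂ n⌉ + 1 bits) followed by O(Δ) floats and ports of O(log log n) bits:
-- the rounded span of u and, for each child, its block and canonical port.
-- Rounding inflates spans by a factor 1 + O(1/A) per light edge and a path
-- has at most log₂ n light edges, so A ≈ 16 log₂ n keeps spans below 2n.
module Submission where

open import Defs
open import Data.Nat using (ℕ; _+_; _*_; _≤_)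
open import Data.Nat.Logarithm using (⌈log₂_⌉)
open import Data.Product using (Σ-syntax)

open import Data.Nat
open import Data.Nat.Properties
open import Data.Nat.Tactic.RingSolver using (solve-∀)
open import Data.Nat.Induction using (<-rec)
open import Data.Nat.Logarithm using (⌈log₂⌉-mono-≤; ⌈log₂⌈n/2⌉⌉≡⌈log₂n⌉∸1)
open import Data.Nat.DivMod using (_/_; m/n*n≤m; m*n/n≡m; /-monoˡ-≤)
open import Data.Bool using (Bool; true; false)
open import Data.List using (List; []; _∷_; _++_; length; take; drop)
open import Data.List.Properties using (length-++)
open import Data.List.Relation.Unary.All using (All; []; _∷_)
open import Data.Product using (_×_; _,_; proj₁; proj₂; map₁)
open import Relation.Binary.PropositionalEquality
open import Function using (_∘_)
open import Data.Fin using (Fin; zero; suc; toℕ)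
open import Data.Fin.Properties using (toℕ-injective) renaming (_≟_ to _≟ᶠ_; suc-injective to fsuc-injective)
open import Data.Sum using (_⊎_; inj₁; inj₂)
open import Data.Empty using (⊥-elim)
open import Relation.Nullary using (¬_; Dec; yes; no)
open import Relation.Binary.Definitions using (tri<; tri≈; tri>)

-- Fixed-width binary codes of numbers and of lists of numbers.
module Bits where

  lowBit : ℕ → Bool
  lowBit zero          = false
  lowBit (suc zero)    = true
  lowBit (suc (suc n)) = lowBit n

  bitValue : Bool → ℕ
  bitValue true  = 1
  bitValue false = 0

  lowBit+2*⌊/2⌋ : ∀ x → bitValue (lowBit x) + 2 * ⌊ x /2⌋ ≡ x
  lowBit+2*⌊/2⌋ zero          = refl
  lowBit+2*⌊/2⌋ (suc zero)    = refl
  lowBit+2*⌊/2⌋ (suc (suc x)) = begin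
    bitValue (lowBit x) + 2 * suc ⌊ x /2⌋   ≡⟨ shift (bitValue (lowBit x)) ⌊ x /2⌋ ⟩
    2 + (bitValue (lowBit x) + 2 * ⌊ x /2⌋) ≡⟨ cong (2 +_) (lowBit+2*⌊/2⌋ x) ⟩
    suc (suc x)                             ∎
    where
    open ≡-Reasoning
    shift : ∀ a h → a + 2 * suc h ≡ 2 + (a + 2 * h)
    shift = solve-∀

  -- the w lowest binary digits of x, least significant first
  toBits : ℕ → ℕ → List Bool
  toBits zero    x = []
  toBits (suc w) x = lowBit x ∷ toBits w ⌊ x /2⌋

  fromBits : List Bool → ℕ
  fromBits []       = 0
  fromBits (b ∷ bs) = bitValue b + 2 * fromBits bs

  length-toBits : ∀ w x → length (toBits w x) ≡ w
  length-toBits zero    x = refl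
  length-toBits (suc w) x = cong suc (length-toBits w ⌊ x /2⌋)

  fromBits-toBits : ∀ w x → x < 2 ^ w → fromBits (toBits w x) ≡ x
  fromBits-toBits zero    zero    _        = refl
  fromBits-toBits zero    (suc x) (s≤s ())
  fromBits-toBits (suc w) x       lt = begin
    bitValue (lowBit x) + 2 * fromBits (toBits w ⌊ x /2⌋)
      ≡⟨ cong (λ y → bitValue (lowBit x) + 2 * y) (fromBits-toBits w ⌊ x /2⌋ half<) ⟩
    bitValue (lowBit x) + 2 * ⌊ x /2⌋
      ≡⟨ lowBit+2*⌊/2⌋ x ⟩
    x ∎
    where
    open ≡-Reasoning
    half< : ⌊ x /2⌋ < 2 ^ w
    half< = *-cancelˡ-< 2 _ _ (≤-<-trans (m≤n+m (2 * ⌊ x /2⌋) (bitValue (lowBit x)))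
              (subst (_< 2 * 2 ^ w) (sym (lowBit+2*⌊/2⌋ x)) lt))

  take-toBits : ∀ w x rest → take w (toBits w x ++ rest) ≡ toBits w x
  take-toBits zero    x rest = refl
  take-toBits (suc w) x rest = cong (lowBit x ∷_) (take-toBits w ⌊ x /2⌋ rest)

  drop-toBits : ∀ w x rest → drop w (toBits w x ++ rest) ≡ rest
  drop-toBits zero    x rest = refl
  drop-toBits (suc w) x rest = drop-toBits w ⌊ x /2⌋ rest

  read-prefix : ∀ w x rest → x < 2 ^ w → fromBits (take w (toBits w x ++ rest)) ≡ x
  read-prefix w x rest x< = trans (cong fromBits (take-toBits w x rest)) (fromBits-toBits w x x<)

  encodeNums : ℕ → List ℕ → List Bool
  encodeNums w []       = []
  encodeNums w (x ∷ xs) = toBits (suc w) x ++ encodeNums w xs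

  decodeNums : ℕ → ℕ → List Bool → List ℕ
  decodeNums w zero       _          = []
  decodeNums w (suc fuel) []         = []
  decodeNums w (suc fuel) l@(_ ∷ _)  = fromBits (take (suc w) l) ∷ decodeNums w fuel (drop (suc w) l)

  length-encodeNums : ∀ w xs → length (encodeNums w xs) ≡ suc w * length xs
  length-encodeNums w []       = sym (*-zeroʳ (suc w))
  length-encodeNums w (x ∷ xs) = begin
    length (toBits (suc w) x ++ encodeNums w xs) ≡⟨ length-++ (toBits (suc w) x) ⟩
    length (toBits (suc w) x) + length (encodeNums w xs)
      ≡⟨ cong₂ _+_ (length-toBits (suc w) x) (length-encodeNums w xs) ⟩
    suc w + suc w * length xs ≡⟨ sym (*-suc (suc w) (length xs)) ⟩
    suc w * suc (length xs) ∎
    where open ≡-Reasoning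

  decode-encode : ∀ w fuel xs → length xs ≤ fuel → All (_< 2 ^ suc w) xs →
                  decodeNums w fuel (encodeNums w xs) ≡ xs
  decode-encode w zero       []       _         _         = refl
  decode-encode w (suc fuel) []       _         _         = refl
  decode-encode w (suc fuel) (x ∷ xs) (s≤s len) (x< ∷ xs<) = cong₂ _∷_
    (read-prefix (suc w) x (encodeNums w xs) x<)
    (trans (cong (decodeNums w fuel) (drop-toBits (suc w) x (encodeNums w xs)))
           (decode-encode w fuel xs len xs<))

module Sums where

  sumFin-ext : ∀ k {f g : Fin k → ℕ} → (∀ j → f j ≡ g j) → sumFin k f ≡ sumFin k g
  sumFin-ext zero    eq = refl
  sumFin-ext (suc k) eq = cong₂ _+_ (eq zero) (sumFin-ext k (eq ∘ suc))

  sumFin-mono : ∀ k {f g : Fin k → ℕ} → (∀ j → f j ≤ g j) → sumFin k f ≤ sumFin k g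
  sumFin-mono zero    le = z≤n
  sumFin-mono (suc k) le = +-mono-≤ (le zero) (sumFin-mono k (le ∘ suc))

  sumFin-strict : ∀ k {f g : Fin k → ℕ} (i : Fin k) →
                  (∀ j → f j ≤ g j) → f i < g i → sumFin k f < sumFin k g
  sumFin-strict (suc k) zero    le lt = +-mono-<-≤ lt (sumFin-mono k (le ∘ suc))
  sumFin-strict (suc k) (suc i) le lt = +-mono-≤-< (le zero) (sumFin-strict k i (le ∘ suc) lt)

  sumFin-const : ∀ k c → sumFin k (λ _ → c) ≡ k * c
  sumFin-const zero    c = refl
  sumFin-const (suc k) c = cong (c +_) (sumFin-const k c)

  sumFin-scale : ∀ k c (f : Fin k → ℕ) → sumFin k (λ j → c * f j) ≡ c * sumFin k f
  sumFin-scale zero    c f = sym (*-zeroʳ c)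
  sumFin-scale (suc k) c f = trans (cong (c * f zero +_) (sumFin-scale k c (f ∘ suc)))
                                   (sym (*-distribˡ-+ c (f zero) _))

  term≤sumFin : ∀ k (f : Fin k → ℕ) i → f i ≤ sumFin k f
  term≤sumFin (suc k) f zero    = m≤m+n (f zero) _
  term≤sumFin (suc k) f (suc i) = ≤-trans (term≤sumFin k (f ∘ suc) i) (m≤n+m _ (f zero))

  sumFin-indicator : ∀ k (f : Fin k → ℕ) i → (∀ j → f j ≤ 1) → f i ≡ 0 → sumFin k f < k
  sumFin-indicator k f i ≤1 fi≡0 =
    ≤-trans (sumFin-strict k i ≤1 (subst (_< 1) (sym fi≡0) z<s))
            (≤-reflexive (trans (sumFin-const k 1) (*-identityʳ k)))

  maskAt : ∀ {k} → Fin k → (Fin k → ℕ) → Fin k → ℕ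
  maskAt h g j with j ≟ᶠ h
  ... | yes _ = 0
  ... | no  _ = g j

  maskAt-here : ∀ {k} (h : Fin k) g → maskAt h g h ≡ 0
  maskAt-here h g with h ≟ᶠ h
  ... | yes _  = refl
  ... | no h≢h = ⊥-elim (h≢h refl)

  maskAt-there : ∀ {k} (h j : Fin k) g → ¬ j ≡ h → maskAt h g j ≡ g j
  maskAt-there h j g j≢h with j ≟ᶠ h
  ... | yes j≡h = ⊥-elim (j≢h j≡h)
  ... | no  _   = refl

  maskAt-≤ : ∀ {k} (h j : Fin k) g → maskAt h g j ≤ g j
  maskAt-≤ h j g with j ≟ᶠ h
  ... | yes _ = z≤n
  ... | no  _ = ≤-refl

  sumFin-maskAt : ∀ k (h : Fin k) (g : Fin k → ℕ) → sumFin k (maskAt h g) + g h ≡ sumFin k g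
  sumFin-maskAt (suc k) zero g = begin
    maskAt zero g zero + sumFin k (maskAt zero g ∘ suc) + g zero
      ≡⟨ cong (λ x → x + sumFin k (maskAt zero g ∘ suc) + g zero) (maskAt-here zero g) ⟩
    sumFin k (maskAt zero g ∘ suc) + g zero
      ≡⟨ +-comm _ (g zero) ⟩
    g zero + sumFin k (maskAt zero g ∘ suc)
      ≡⟨ cong (g zero +_) (sumFin-ext k (λ j → maskAt-there zero (suc j) g λ ())) ⟩
    g zero + sumFin k (g ∘ suc) ∎
    where open ≡-Reasoning
  sumFin-maskAt (suc k) (suc h) g = begin
    maskAt (suc h) g zero + sumFin k (maskAt (suc h) g ∘ suc) + g (suc h)
      ≡⟨ cong (λ x → x + sumFin k (maskAt (suc h) g ∘ suc) + g (suc h)) (maskAt-there (suc h) zero g λ ()) ⟩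
    g zero + sumFin k (maskAt (suc h) g ∘ suc) + g (suc h)
      ≡⟨ +-assoc (g zero) _ _ ⟩
    g zero + (sumFin k (maskAt (suc h) g ∘ suc) + g (suc h))
      ≡⟨ cong (λ x → g zero + (x + g (suc h))) (sumFin-ext k shift) ⟩
    g zero + (sumFin k (maskAt h (g ∘ suc)) + g (suc h))
      ≡⟨ cong (g zero +_) (sumFin-maskAt k h (g ∘ suc)) ⟩
    g zero + sumFin k (g ∘ suc) ∎
    where
    open ≡-Reasoning
    shift : ∀ j → maskAt (suc h) g (suc j) ≡ maskAt h (g ∘ suc) j
    shift j with suc j ≟ᶠ suc h | j ≟ᶠ h
    ... | yes _    | yes _   = refl
    ... | no  _    | no  _   = refl
    ... | yes sj≡sh | no j≢h = ⊥-elim (j≢h (fsuc-injective sj≡sh))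
    ... | no sj≢sh | yes j≡h = ⊥-elim (sj≢sh (cong suc j≡h))

  two-terms≤sumFin : ∀ k (f : Fin k → ℕ) i h → ¬ i ≡ h → f i + f h ≤ sumFin k f
  two-terms≤sumFin k f i h i≢h = begin
    f i + f h                   ≡⟨ cong (_+ f h) (sym (maskAt-there h i f i≢h)) ⟩
    maskAt h f i + f h          ≤⟨ +-monoˡ-≤ (f h) (term≤sumFin k (maskAt h f) i) ⟩
    sumFin k (maskAt h f) + f h ≡⟨ sumFin-maskAt k h f ⟩
    sumFin k f                  ∎
    where open ≤-Reasoning

  -- blocks of lengths B 0, B 1, … laid out consecutively from 0:
  -- block i occupies [offset B i, offset B i + B i)
  offset : ∀ {k} → (Fin k → ℕ) → Fin k → ℕ
  offset B zero    = 0
  offset B (suc i) = B zero + offset (B ∘ suc) i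

  block-end≤sumFin : ∀ k (B : Fin k → ℕ) i → offset B i + B i ≤ sumFin k B
  block-end≤sumFin (suc k) B zero    = m≤m+n (B zero) _
  block-end≤sumFin (suc k) B (suc i) =
    ≤-trans (≤-reflexive (+-assoc (B zero) _ _)) (+-monoʳ-≤ (B zero) (block-end≤sumFin k (B ∘ suc) i))

  block-end≤offset : ∀ {k} (B : Fin k → ℕ) i j → toℕ i < toℕ j → offset B i + B i ≤ offset B j
  block-end≤offset B zero    (suc j) _         = m≤m+n (B zero) _
  block-end≤offset B (suc i) (suc j) (s≤s i<j) =
    ≤-trans (≤-reflexive (+-assoc (B zero) _ _)) (+-monoʳ-≤ (B zero) (block-end≤offset (B ∘ suc) i j i<j))

  argmax : ∀ k → (Fin (suc k) → ℕ) → Fin (suc k)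
  argmax zero    s = zero
  argmax (suc k) s with s zero ≤? s (suc (argmax k (s ∘ suc)))
  ... | yes _ = suc (argmax k (s ∘ suc))
  ... | no  _ = zero

  argmax-max : ∀ k (s : Fin (suc k) → ℕ) j → s j ≤ s (argmax k s)
  argmax-max zero    s zero = ≤-refl
  argmax-max (suc k) s j with s zero ≤? s (suc (argmax k (s ∘ suc)))
  argmax-max (suc k) s zero    | yes s0≤ = s0≤
  argmax-max (suc k) s (suc j) | yes _   = argmax-max k (s ∘ suc) j
  argmax-max (suc k) s zero    | no  _   = ≤-refl
  argmax-max (suc k) s (suc j) | no  s0≰ = ≤-trans (argmax-max k (s ∘ suc) j) (<⇒≤ (≰⇒> s0≰))

-- Canonical port numbers.  Children are ranked by decreasing subtree size s,
-- ties broken by index; the port of child i is 1 + the number of children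
-- ranked before it.
module CanonicalPorts {k : ℕ} (s : Fin k → ℕ) where
  open Sums

  Before : Fin k → Fin k → Set
  Before j i = s i < s j ⊎ (s j ≡ s i × toℕ j < toℕ i)

  before? : ∀ j i → Dec (Before j i)
  before? j i with s i <? s j
  ... | yes si<sj = yes (inj₁ si<sj)
  ... | no  si≮sj with s j ≟ s i | toℕ j <? toℕ i
  ...   | yes sj≡si | yes j<i = yes (inj₂ (sj≡si , j<i))
  ...   | no  sj≢si | _       = no λ { (inj₁ p) → si≮sj p ; (inj₂ (e , _)) → sj≢si e }
  ...   | _         | no j≮i  = no λ { (inj₁ p) → si≮sj p ; (inj₂ (_ , l)) → j≮i l }

  before-irrefl : ∀ i → ¬ Before i i
  before-irrefl i (inj₁ p)       = <-irrefl refl p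
  before-irrefl i (inj₂ (_ , l)) = <-irrefl refl l

  before-trans : ∀ {i j l} → Before i j → Before j l → Before i l
  before-trans         (inj₁ p)       (inj₁ q)        = inj₁ (<-trans q p)
  before-trans {i}     (inj₁ p)       (inj₂ (e , _))  = inj₁ (subst (_< s i) e p)
  before-trans {l = l} (inj₂ (e , _)) (inj₁ q)        = inj₁ (subst (s l <_) (sym e) q)
  before-trans         (inj₂ (e , p)) (inj₂ (e′ , q)) = inj₂ (trans e e′ , <-trans p q)

  before-total : ∀ i j → ¬ i ≡ j → Before i j ⊎ Before j i
  before-total i j i≢j with <-cmp (s i) (s j)
  ... | tri< si<sj _ _ = inj₂ (inj₁ si<sj)
  ... | tri> _ _ sj<si = inj₁ (inj₁ sj<si)
  ... | tri≈ _ si≡sj _ with <-cmp (toℕ i) (toℕ j)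
  ...   | tri< i<j _ _ = inj₁ (inj₂ (si≡sj , i<j))
  ...   | tri≈ _ i≡j _ = ⊥-elim (i≢j (toℕ-injective i≡j))
  ...   | tri> _ _ j<i = inj₂ (inj₂ (sym si≡sj , j<i))

  isBefore : Fin k → Fin k → ℕ
  isBefore i j with before? j i
  ... | yes _ = 1
  ... | no  _ = 0

  port : Fin k → ℕ
  port i = suc (sumFin k (isBefore i))

  port-range : ∀ i → 1 ≤ port i × port i ≤ k
  port-range i = s≤s z≤n , sumFin-indicator k (isBefore i) i ≤1 not-self
    where
    ≤1 : ∀ j → isBefore i j ≤ 1
    ≤1 j with before? j i
    ... | yes _ = ≤-refl
    ... | no  _ = z≤n
    not-self : isBefore i i ≡ 0
    not-self with before? i i
    ... | yes ii = ⊥-elim (before-irrefl i ii)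
    ... | no  _  = refl

  -- everything ranked before i is ranked before j, and so is i itself
  port-strict : ∀ i j → Before i j → port i < port j
  port-strict i j i<j = s≤s (sumFin-strict k i pointwise at-i)
    where
    pointwise : ∀ l → isBefore i l ≤ isBefore j l
    pointwise l with before? l i | before? l j
    ... | yes _   | yes _   = ≤-refl
    ... | no  _   | _       = z≤n
    ... | yes l<i | no  l≮j = ⊥-elim (l≮j (before-trans l<i i<j))
    at-i : isBefore i i < isBefore j i
    at-i with before? i i | before? i j
    ... | yes ii | _      = ⊥-elim (before-irrefl i ii)
    ... | no  _  | yes _  = ≤-refl
    ... | no  _  | no i≮j = ⊥-elim (i≮j i<j)

  port-injective : ∀ {i j} → port i ≡ port j → i ≡ j
  port-injective {i} {j} eq with i ≟ᶠ j
  ... | yes i≡j = i≡j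
  ... | no  i≢j with before-total i j i≢j
  ...   | inj₁ i<j = ⊥-elim (<-irrefl eq (port-strict i j i<j))
  ...   | inj₂ j<i = ⊥-elim (<-irrefl (sym eq) (port-strict j i j<i))

  port-canonical : ∀ i j → port i < port j → s j ≤ s i
  port-canonical i j lt with s i <? s j
  ... | yes si<sj = ⊥-elim (<-asym lt (port-strict j i (inj₁ si<sj)))
  ... | no  si≮sj = ≮⇒≥ si≮sj

portOf : (t : Tree) → Fin (deg t) → ℕ
portOf t = CanonicalPorts.port (λ j → size (kid t j))

-- Approximate sizes.  A number is stored in O(log log n) bits as a
-- "float" m · 2^e whose mantissa m is at most A.
float : ℕ → ℕ → ℕ
float e m = m * 2 ^ e

float-double : ∀ e m → float (suc e) m ≡ 2 * float e m
float-double e m = swap m (2 ^ e)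
  where
  swap : ∀ m x → m * (2 * x) ≡ 2 * (m * x)
  swap = solve-∀

r≤2*⌈r/2⌉ : ∀ r → r ≤ 2 * ⌈ r /2⌉
r≤2*⌈r/2⌉ r = begin
  r                       ≡⟨ sym (⌊n/2⌋+⌈n/2⌉≡n r) ⟩
  ⌊ r /2⌋ + ⌈ r /2⌉       ≤⟨ +-monoˡ-≤ ⌈ r /2⌉ (⌊n/2⌋≤⌈n/2⌉ r) ⟩
  ⌈ r /2⌉ + ⌈ r /2⌉       ≡⟨ cong (⌈ r /2⌉ +_) (sym (+-identityʳ ⌈ r /2⌉)) ⟩
  2 * ⌈ r /2⌉             ∎
  where open ≤-Reasoning

2*⌈r/2⌉≤1+r : ∀ r → 2 * ⌈ r /2⌉ ≤ suc r
2*⌈r/2⌉≤1+r r = ≤-trans (m≤n+m _ (Bits.bitValue (Bits.lowBit (suc r))))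
                        (≤-reflexive (Bits.lowBit+2*⌊/2⌋ (suc r)))

module Rounding (A-1 : ℕ) where

  A : ℕ
  A = suc A-1

  -- (exponent , mantissa) of r rounded up, using at most f halvings
  round : ℕ → ℕ → ℕ × ℕ
  round zero    r = 0 , r
  round (suc f) r with r ≤? A
  ... | yes _ = 0 , r
  ... | no  _ = map₁ suc (round f ⌈ r /2⌉)

  exp mant rounded : ℕ → ℕ → ℕ
  exp f r = proj₁ (round f r)
  mant f r = proj₂ (round f r)
  rounded f r = float (exp f r) (mant f r)

  round-zero : ∀ f → round f 0 ≡ (0 , 0)
  round-zero zero    = refl
  round-zero (suc f) = refl

  exp≤fuel : ∀ f r → exp f r ≤ f
  exp≤fuel zero    r = z≤n
  exp≤fuel (suc f) r with r ≤? A
  ... | yes _ = z≤n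
  ... | no  _ = s≤s (exp≤fuel f ⌈ r /2⌉)

  mant≤A : ∀ f r → r ≤ A * 2 ^ f → mant f r ≤ A
  mant≤A zero    r r≤A = ≤-trans r≤A (≤-reflexive (*-identityʳ A))
  mant≤A (suc f) r r≤ with r ≤? A
  ... | yes r≤A = r≤A
  ... | no  _   = mant≤A f ⌈ r /2⌉ (begin
      ⌈ r /2⌉                           ≤⟨ ⌈n/2⌉-mono r≤ ⟩
      ⌈ A * 2 ^ suc f /2⌉               ≡⟨ cong ⌈_/2⌉ (float-double f A) ⟩
      ⌈ 2 * (A * 2 ^ f) /2⌉             ≡⟨ cong (λ x → ⌈ A * 2 ^ f + x /2⌉) (+-identityʳ (A * 2 ^ f)) ⟩
      ⌈ A * 2 ^ f + A * 2 ^ f /2⌉       ≡⟨ sym (n≡⌈n+n/2⌉ (A * 2 ^ f)) ⟩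
      A * 2 ^ f                         ∎)
    where open ≤-Reasoning

  rounded-≥ : ∀ f r → r ≤ rounded f r
  rounded-≥ zero    r = ≤-reflexive (sym (*-identityʳ r))
  rounded-≥ (suc f) r with r ≤? A
  ... | yes _ = ≤-reflexive (sym (*-identityʳ r))
  ... | no  _ = begin
      r                            ≤⟨ r≤2*⌈r/2⌉ r ⟩
      2 * ⌈ r /2⌉                  ≤⟨ *-monoʳ-≤ 2 (rounded-≥ f ⌈ r /2⌉) ⟩
      2 * rounded f ⌈ r /2⌉        ≡⟨ sym (float-double (exp f ⌈ r /2⌉) (mant f ⌈ r /2⌉)) ⟩
      float (suc (exp f ⌈ r /2⌉)) (mant f ⌈ r /2⌉) ∎
    where open ≤-Reasoning

  rounded-< : ∀ f r → rounded f r < r + 2 ^ exp f r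
  rounded-< zero    r = ≤-reflexive (trans (cong suc (*-identityʳ r)) (+-comm 1 r))
  rounded-< (suc f) r with r ≤? A
  ... | yes _ = ≤-reflexive (trans (cong suc (*-identityʳ r)) (+-comm 1 r))
  ... | no  _ = ≤-pred (begin
      2 + float (suc e) m          ≡⟨ cong (2 +_) (float-double e m) ⟩
      2 + 2 * rounded f h          ≡⟨ sym (*-suc 2 (rounded f h)) ⟩
      2 * suc (rounded f h)        ≤⟨ *-monoʳ-≤ 2 (rounded-< f h) ⟩
      2 * (h + 2 ^ e)              ≡⟨ *-distribˡ-+ 2 h (2 ^ e) ⟩
      2 * h + 2 ^ suc e            ≤⟨ +-monoˡ-≤ (2 ^ suc e) (2*⌈r/2⌉≤1+r r) ⟩
      suc r + 2 ^ suc e            ∎)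
    where
    open ≤-Reasoning
    h = ⌈ r /2⌉
    e = exp f h
    m = mant f h

  exp-scaled : ∀ f r e → exp f r ≡ suc e → A * 2 ^ e < r
  exp-scaled (suc f) r e eq with r ≤? A
  exp-scaled (suc f) r e  () | yes _
  exp-scaled (suc f) r e  eq | no r≰A with exp f ⌈ r /2⌉ | exp-scaled f ⌈ r /2⌉
  exp-scaled (suc f) r .0       refl | no r≰A | zero   | _  =
    subst (_< r) (sym (*-identityʳ A)) (≰⇒> r≰A)
  exp-scaled (suc f) r .(suc e) refl | no r≰A | suc e  | ih = ≤-pred (begin
      2 + A * 2 ^ suc e            ≡⟨ cong (2 +_) (float-double e A) ⟩
      2 + 2 * (A * 2 ^ e)          ≡⟨ sym (*-suc 2 (A * 2 ^ e)) ⟩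
      2 * suc (A * 2 ^ e)          ≤⟨ *-monoʳ-≤ 2 (ih e refl) ⟩
      2 * ⌈ r /2⌉                  ≤⟨ 2*⌈r/2⌉≤1+r r ⟩
      suc r                        ∎)
    where open ≤-Reasoning

  rounding-error : ∀ f r → A * rounded f r ≤ A * r + 2 * r
  rounding-error f r = bound (exp f r) (mant f r) (rounded-< f r) (exp-scaled f r)
    where
    open ≤-Reasoning
    bound : ∀ e m → float e m < r + 2 ^ e → (∀ e′ → e ≡ suc e′ → A * 2 ^ e′ < r) →
            A * float e m ≤ A * r + 2 * r
    bound zero    m lt _      = ≤-trans (*-monoʳ-≤ A (≤-pred (subst (float 0 m <_) (+-comm r 1) lt)))
                                        (m≤m+n (A * r) (2 * r))
    bound (suc e) m lt scaled = begin
      A * float (suc e) m        ≤⟨ *-monoʳ-≤ A (<⇒≤ lt) ⟩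
      A * (r + 2 ^ suc e)        ≡⟨ *-distribˡ-+ A r _ ⟩
      A * r + A * 2 ^ suc e      ≡⟨ cong (A * r +_) (float-double e A) ⟩
      A * r + 2 * (A * 2 ^ e)    ≤⟨ +-monoʳ-≤ (A * r) (*-monoʳ-≤ 2 (<⇒≤ (scaled e refl))) ⟩
      A * r + 2 * r              ∎

  -- the slack ⌊2r/A⌋ that absorbs the rounding error of anything of size ≤ r
  slack : ℕ → ℕ
  slack r = (2 * r) / A

  A*slack≤2r : ∀ r → A * slack r ≤ 2 * r
  A*slack≤2r r = ≤-trans (≤-reflexive (*-comm A (slack r))) (m/n*n≤m (2 * r) A)

  ≤slack : ∀ x r → A * x ≤ 2 * r → x ≤ slack r
  ≤slack x r le = ≤-trans (≤-reflexive (sym (m*n/n≡m x A)))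
                          (/-monoˡ-≤ A (≤-trans (≤-reflexive (*-comm x A)) le))

  rounded-≤+slack : ∀ f r′ r → r′ ≤ r → rounded f r′ ≤ r′ + slack r
  rounded-≤+slack f r′ r r′≤r = ≤-trans (m≤n+m∸n x r′) (+-monoʳ-≤ r′ (≤slack (x ∸ r′) r excess))
    where
    open ≤-Reasoning
    x = rounded f r′
    excess : A * (x ∸ r′) ≤ 2 * r
    excess = begin
      A * (x ∸ r′)              ≡⟨ *-distribˡ-∸ A x r′ ⟩
      A * x ∸ A * r′            ≤⟨ ∸-monoˡ-≤ (A * r′) (rounding-error f r′) ⟩
      A * r′ + 2 * r′ ∸ A * r′  ≡⟨ m+n∸m≡n (A * r′) (2 * r′) ⟩
      2 * r′                    ≤⟨ *-monoʳ-≤ 2 r′≤r ⟩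
      2 * r                     ∎

-- Routing tables.  A table is a flat list e₀ ∷ m₀ ∷ p₀ ∷ e₁ ∷ m₁ ∷ p₁ ∷ … of
-- consecutive blocks, block i having length float eᵢ mᵢ and answer pᵢ.
-- Looking up a position returns the answer of the block containing it, and
-- a default answer beyond the last block.
module Tables where
  open Sums

  table : ∀ k → (Fin k → ℕ) → (Fin k → ℕ) → (Fin k → ℕ) → List ℕ
  table zero    E M P = []
  table (suc k) E M P = E zero ∷ M zero ∷ P zero ∷ table k (E ∘ suc) (M ∘ suc) (P ∘ suc)

  lookupTable : ℕ → List ℕ → ℕ → ℕ
  lookupTable d (e ∷ m ∷ p ∷ rest) default with d <? float e m
  ... | yes _ = p
  ... | no  _ = lookupTable (d ∸ float e m) rest default
  lookupTable d _ default = default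

  lookup-first : ∀ d e m p rest default → d < float e m → lookupTable d (e ∷ m ∷ p ∷ rest) default ≡ p
  lookup-first d e m p rest default d< with d <? float e m
  ... | yes _  = refl
  ... | no  d≮ = ⊥-elim (d≮ d<)

  lookup-skip : ∀ d e m p rest default →
                lookupTable (float e m + d) (e ∷ m ∷ p ∷ rest) default ≡ lookupTable d rest default
  lookup-skip d e m p rest default with float e m + d <? float e m
  ... | yes lt = ⊥-elim (<-irrefl refl (≤-trans lt (m≤m+n (float e m) d)))
  ... | no  _  = cong (λ x → lookupTable x rest default) (m+n∸m≡n (float e m) d)

  module _ {k : ℕ} (E M : Fin k → ℕ) where
    blocks : Fin k → ℕ
    blocks j = float (E j) (M j)

  lookup-block : ∀ k (E M P : Fin k → ℕ) i q default → q < blocks E M i →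
                 lookupTable (offset (blocks E M) i + q) (table k E M P) default ≡ P i
  lookup-block (suc k) E M P zero    q default q< = lookup-first q (E zero) (M zero) (P zero) _ default q<
  lookup-block (suc k) E M P (suc i) q default q< = begin
    lookupTable (blocks E M zero + offset (blocks E M ∘ suc) i + q) (table (suc k) E M P) default
      ≡⟨ cong (λ x → lookupTable x (table (suc k) E M P) default) (+-assoc (blocks E M zero) _ q) ⟩
    lookupTable (blocks E M zero + (offset (blocks E M ∘ suc) i + q)) (table (suc k) E M P) default
      ≡⟨ lookup-skip _ (E zero) (M zero) (P zero) _ default ⟩
    lookupTable (offset (blocks (E ∘ suc) (M ∘ suc)) i + q) (table k (E ∘ suc) (M ∘ suc) (P ∘ suc)) default
      ≡⟨ lookup-block k (E ∘ suc) (M ∘ suc) (P ∘ suc) i q default q< ⟩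
    P (suc i) ∎
    where open ≡-Reasoning

  lookup-beyond : ∀ k (E M P : Fin k → ℕ) q default →
                  lookupTable (sumFin k (blocks E M) + q) (table k E M P) default ≡ default
  lookup-beyond zero    E M P q default = refl
  lookup-beyond (suc k) E M P q default = begin
    lookupTable (blocks E M zero + sumFin k (blocks E M ∘ suc) + q) (table (suc k) E M P) default
      ≡⟨ cong (λ x → lookupTable x (table (suc k) E M P) default) (+-assoc (blocks E M zero) _ q) ⟩
    lookupTable (blocks E M zero + (sumFin k (blocks E M ∘ suc) + q)) (table (suc k) E M P) default
      ≡⟨ lookup-skip _ (E zero) (M zero) (P zero) _ default ⟩
    lookupTable (sumFin k (blocks (E ∘ suc) (M ∘ suc)) + q) (table k (E ∘ suc) (M ∘ suc) (P ∘ suc)) default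
      ≡⟨ lookup-beyond k (E ∘ suc) (M ∘ suc) (P ∘ suc) q default ⟩
    default ∎
    where open ≡-Reasoning

  length-table : ∀ k E M P → length (table k E M P) ≡ 3 * k
  length-table zero    E M P = refl
  length-table (suc k) E M P = trans (cong (3 +_) (length-table k (E ∘ suc) (M ∘ suc) (P ∘ suc)))
                                     (sym (*-suc 3 k))

  table-entries< : ∀ {X} k (E M P : Fin k → ℕ) →
                   (∀ j → E j < X) → (∀ j → M j < X) → (∀ j → P j < X) → All (_< X) (table k E M P)
  table-entries< zero    E M P e< m< p< = []
  table-entries< (suc k) E M P e< m< p< =
    e< zero ∷ m< zero ∷ p< zero ∷ table-entries< k (E ∘ suc) (M ∘ suc) (P ∘ suc) (e< ∘ suc) (m< ∘ suc) (p< ∘ suc)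

-- The layout.  Each tree t is given span t ≥ |t| consecutive positions: its
-- root takes the first one, then come the light children, each in a block of
-- length padded (span child) (its span plus slack, rounded up to a float),
-- and last the heaviest child, in exactly its span.  The padding guarantees
-- that the rounded span of any node still ends inside the enclosing light
-- block, so rounded spans separate descendants from all other nodes.
module Layout (A-1 fuel : ℕ) where
  open Rounding A-1
  open Sums
  open Tables

  padded : ℕ → ℕ
  padded r = rounded fuel (r + slack r)

  heavy : ∀ k → (Fin (suc k) → Tree) → Fin (suc k)
  heavy k f = argmax k (λ j → size (f j))

  -- what the children with spans r ask for: the heavy child h gets no block
  demand : ∀ {k} → Fin k → (Fin k → ℕ) → Fin k → ℕ
  demand h r = maskAt h (λ j → r j + slack (r j))

  blockExp blockMant : ∀ {k} → Fin k → (Fin k → ℕ) → Fin k → ℕ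
  blockExp  h r j = exp fuel (demand h r j)
  blockMant h r j = mant fuel (demand h r j)

  span : Tree → ℕ
  span (node zero    f) = 1
  span (node (suc k) f) = suc (sumFin (suc k) (blocks (blockExp h r) (blockMant h r)) + r h)
    where
    h = heavy k f
    r = λ j → span (f j)

  module Children (k : ℕ) (f : Fin (suc k) → Tree) where
    h : Fin (suc k)
    h = heavy k f

    r : Fin (suc k) → ℕ
    r j = span (f j)

    E M B : Fin (suc k) → ℕ
    E = blockExp h r
    M = blockMant h r
    B = blocks E M

    lightTotal : ℕ
    lightTotal = sumFin (suc k) B

    -- child i starts at position 1 + childOffset i relative to its parent
    childOffset : Fin (suc k) → ℕ
    childOffset i with i ≟ᶠ h
    ... | yes _ = lightTotal
    ... | no  _ = offset B i

    block-heavy : B h ≡ 0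
    block-heavy = begin
      rounded fuel (demand h r h) ≡⟨ cong (rounded fuel) (maskAt-here h (λ j → r j + slack (r j))) ⟩
      rounded fuel 0              ≡⟨ cong (λ p → float (proj₁ p) (proj₂ p)) (round-zero fuel) ⟩
      0                           ∎
      where open ≡-Reasoning

    block-light : ∀ i → ¬ i ≡ h → B i ≡ padded (r i)
    block-light i i≢h = cong (rounded fuel) (maskAt-there h i (λ j → r j + slack (r j)) i≢h)

    span≤padded : ∀ i → r i ≤ padded (r i)
    span≤padded i = ≤-trans (m≤m+n (r i) (slack (r i))) (rounded-≥ fuel (r i + slack (r i)))

    light-span-fits : ∀ i → ¬ i ≡ h → offset B i + r i ≤ offset B i + B i
    light-span-fits i i≢h = +-monoʳ-≤ (offset B i) (subst (r i ≤_) (sym (block-light i i≢h)) (span≤padded i))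

    child-fits : ∀ i → suc (childOffset i) + r i ≤ span (node (suc k) f)
    child-fits i with i ≟ᶠ h
    ... | yes refl = ≤-refl
    ... | no  i≢h  = s≤s (≤-trans (light-span-fits i i≢h)
                                  (≤-trans (block-end≤sumFin (suc k) B i) (m≤m+n lightTotal (r h))))

    children-apart : ∀ i j → ¬ i ≡ j →
      childOffset i + r i ≤ childOffset j ⊎ childOffset j + padded (r j) ≤ childOffset i
    children-apart i j i≢j with i ≟ᶠ h | j ≟ᶠ h
    ... | yes refl | yes refl = ⊥-elim (i≢j refl)
    ... | yes refl | no  j≢h  = inj₂ (subst (λ x → offset B j + x ≤ lightTotal) (block-light j j≢h)
                                             (block-end≤sumFin (suc k) B j))
    ... | no  i≢h  | yes refl = inj₁ (≤-trans (light-span-fits i i≢h) (block-end≤sumFin (suc k) B i))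
    ... | no  i≢h  | no  j≢h  with <-cmp (toℕ i) (toℕ j)
    ...   | tri< i<j _ _ = inj₁ (≤-trans (light-span-fits i i≢h) (block-end≤offset B i j i<j))
    ...   | tri≈ _ i≡j _ = ⊥-elim (i≢j (toℕ-injective i≡j))
    ...   | tri> _ _ j<i = inj₂ (subst (λ x → offset B j + x ≤ offset B i) (block-light j j≢h)
                                       (block-end≤offset B j i j<i))

  childOffset : (t : Tree) → Fin (deg t) → ℕ
  childOffset (node zero    f) ()
  childOffset (node (suc k) f) = Children.childOffset k f

  pos : {t : Tree} → Node t → ℕ
  pos root                        = 0
  pos (child {k} {f} i u) = suc (childOffset (node k f) i) + pos u

  span≥1 : ∀ t → 1 ≤ span t
  span≥1 (node zero    f) = s≤s z≤n
  span≥1 (node (suc k) f) = s≤s z≤n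

  subtree-in-range : ∀ {t} (u : Node t) → pos u + span (sub u) ≤ span t
  subtree-in-range root = ≤-refl
  subtree-in-range (child {suc k} {f} i u) = begin
    suc (Children.childOffset k f i) + pos u + span (sub u)
      ≡⟨ +-assoc (suc (Children.childOffset k f i)) (pos u) _ ⟩
    suc (Children.childOffset k f i) + (pos u + span (sub u))
      ≤⟨ +-monoʳ-≤ (suc (Children.childOffset k f i)) (subtree-in-range u) ⟩
    suc (Children.childOffset k f i) + span (f i)
      ≤⟨ Children.child-fits k f i ⟩
    span (node (suc k) f) ∎
    where open ≤-Reasoning

  pos<span : ∀ {t} (u : Node t) → pos u < span t
  pos<span u = ≤-trans (≤-reflexive (+-comm 1 (pos u)))
                       (≤-trans (+-monoʳ-≤ (pos u) (span≥1 (sub u))) (subtree-in-range u))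

  span-sub≤ : ∀ {t} (u : Node t) → span (sub u) ≤ span t
  span-sub≤ u = ≤-trans (m≤n+m _ (pos u)) (subtree-in-range u)

  extent : {t : Tree} → Node t → ℕ
  extent u = rounded fuel (span (sub u))

  extent-in-padding : ∀ {t} (u : Node t) → pos u + extent u ≤ padded (span t)
  extent-in-padding {t} u = begin
    pos u + extent u                          ≤⟨ +-monoʳ-≤ (pos u) (rounded-≤+slack fuel _ _ (span-sub≤ u)) ⟩
    pos u + (span (sub u) + slack (span t))   ≡⟨ sym (+-assoc (pos u) _ _) ⟩
    pos u + span (sub u) + slack (span t)     ≤⟨ +-monoˡ-≤ (slack (span t)) (subtree-in-range u) ⟩
    span t + slack (span t)                   ≤⟨ rounded-≥ fuel _ ⟩
    padded (span t)                           ∎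
    where open ≤-Reasoning

  outside : ∀ {t} (u w : Node t) → ¬ u ≡ w → (∀ i → ¬ Via u i w) →
            pos w < pos u ⊎ pos u + extent u ≤ pos w
  outside root        root        u≢w _   = ⊥-elim (u≢w refl)
  outside root        (child i w) _   nv  = ⊥-elim (nv i (here i w))
  outside (child j u) root        _   _   = inj₁ (s≤s z≤n)
  outside (child {suc k} {f} j u) (child i w) u≢w nv with i ≟ᶠ j
  ... | yes refl with outside u w (λ u≡w → u≢w (cong (child i) u≡w)) (λ l v → nv l (there i v))
  ...   | inj₁ w<u = inj₁ (+-monoʳ-< (suc (Children.childOffset k f i)) w<u)
  ...   | inj₂ u≤w = inj₂ (≤-trans (≤-reflexive (+-assoc (suc (Children.childOffset k f i)) (pos u) _))
                                   (+-monoʳ-≤ (suc (Children.childOffset k f i)) u≤w))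
  outside (child {suc k} {f} j u) (child i w) u≢w nv | no i≢j with Children.children-apart k f i j i≢j
  ... | inj₁ i-before = inj₁ (s≤s (begin-strict
      offset-i + pos w           <⟨ +-monoʳ-< offset-i (pos<span w) ⟩
      offset-i + span (f i)      ≤⟨ i-before ⟩
      offset-j                   ≤⟨ m≤m+n offset-j (pos u) ⟩
      offset-j + pos u           ∎))
    where
    open ≤-Reasoning
    offset-i = Children.childOffset k f i
    offset-j = Children.childOffset k f j
  ... | inj₂ j-before = inj₂ (begin
      suc offset-j + pos u + extent u      ≡⟨ +-assoc (suc offset-j) (pos u) _ ⟩
      suc offset-j + (pos u + extent u)    ≤⟨ +-monoʳ-≤ (suc offset-j) (extent-in-padding u) ⟩
      suc (offset-j + padded (span (f j))) ≤⟨ s≤s j-before ⟩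
      suc offset-i                         ≤⟨ m≤m+n (suc offset-i) (pos w) ⟩
      suc offset-i + pos w                 ∎)
    where
    open ≤-Reasoning
    offset-i = Children.childOffset k f i
    offset-j = Children.childOffset k f j

  via-position : ∀ {t} {u : Node t} {i w} → Via u i w →
    Σ[ q ∈ ℕ ] (pos w ≡ pos u + suc (childOffset (sub u) i + q)) × (q < span (kid (sub u) i))
  via-position (here {suc k} {f} i w) = pos w , refl , pos<span w
  via-position (there {suc k} {f} j {u} {i} {w} v) with via-position v
  ... | q , pos-w , q< = q , trans (cong (suc (Children.childOffset k f j) +_) pos-w)
                                   (sym (+-assoc (suc (Children.childOffset k f j)) (pos u) _)) , q<

  -- the numbers stored in the label of a node with subtree t: its rounded
  -- span, the port of its heavy child, and the table of its light blocks
  childTable : Tree → List ℕ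
  childTable (node zero    f) = []
  childTable t@(node (suc k) f) =
    portOf t (heavy k f) ∷ table (suc k) (Children.E k f) (Children.M k f) (portOf t)

  nums : Tree → List ℕ
  nums t = exp fuel (span t) ∷ mant fuel (span t) ∷ childTable t

  -- the routing decision from the offset δ = pos w ∸ pos u and the numbers of u
  route : ℕ → List ℕ → ℕ
  route zero    _ = 0
  route (suc δ) (e ∷ m ∷ heavyPort ∷ tbl) with suc δ <? float e m
  ... | yes _ = lookupTable δ tbl heavyPort
  ... | no  _ = 0
  route (suc δ) _ = 0

  route-beyond : ∀ δ t → rounded fuel (span t) ≤ δ → route δ (nums t) ≡ 0
  route-beyond zero    t                _ = refl
  route-beyond (suc δ) (node zero    f) _ = refl
  route-beyond (suc δ) (node (suc k) f) extent≤ with suc δ <? rounded fuel (span (node (suc k) f))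
  ... | yes δ< = ⊥-elim (<⇒≱ δ< extent≤)
  ... | no  _  = refl

  -- offsets inside child i route to the port of i: light blocks are found
  -- in the table, everything after them belongs to the heavy child
  route-child : ∀ t i q → q < span (kid t i) → route (suc (childOffset t i + q)) (nums t) ≡ portOf t i
  route-child t@(node (suc k) f) i q q< with suc (childOffset t i + q) <? rounded fuel (span t)
  ... | no ≮extent = ⊥-elim (≮extent (begin-strict
      suc (childOffset t i + q)       <⟨ s≤s (+-monoʳ-< (childOffset t i) q<) ⟩
      suc (childOffset t i) + span (f i) ≤⟨ Children.child-fits k f i ⟩
      span t                          ≤⟨ rounded-≥ fuel (span t) ⟩
      rounded fuel (span t)           ∎))
    where open ≤-Reasoning
  ... | yes _ with i ≟ᶠ Children.h k f
  ...   | yes refl = lookup-beyond (suc k) (Children.E k f) (Children.M k f) (portOf t) q _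
  ...   | no  i≢h  = lookup-block (suc k) (Children.E k f) (Children.M k f) (portOf t) i q _
                       (subst (q <_) (sym (Children.block-light k f i i≢h))
                              (≤-trans q< (Children.span≤padded k f i)))

  route-via : ∀ {t} (u w : Node t) i → Via u i w → route (pos w ∸ pos u) (nums (sub u)) ≡ portOf (sub u) i
  route-via u w i v with via-position v
  ... | q , pos-w , q< rewrite pos-w | m+n∸m≡n (pos u) (suc (childOffset (sub u) i + q)) =
    route-child (sub u) i q q<

  route-outside : ∀ {t} (u w : Node t) → ¬ u ≡ w → (∀ i → ¬ Via u i w) →
                  route (pos w ∸ pos u) (nums (sub u)) ≡ 0
  route-outside u w u≢w nv with outside u w u≢w nv
  ... | inj₁ w<u = cong (λ δ → route δ (nums (sub u))) (m≤n⇒m∸n≡0 (<⇒≤ w<u))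
  ... | inj₂ u≤w = route-beyond _ (sub u)
                     (≤-trans (≤-reflexive (sym (m+n∸m≡n (pos u) (extent u)))) (∸-monoˡ-≤ (pos u) u≤w))

-- The heavy child is stored exactly; every
-- light child has at most half the size of its parent, so along any path
-- at most H light blocks each inflate the span by a factor 1 + 12/A.
module SpanBound (A-1 fuel : ℕ) where
  open Rounding A-1
  open Layout A-1 fuel
  open Sums

  size≥1 : ∀ t → 1 ≤ size t
  size≥1 (node k f) = s≤s z≤n

  slack≤ : 2 ≤ A → ∀ r → slack r ≤ r
  slack≤ 2≤A r = *-cancelˡ-≤ A (≤-trans (A*slack≤2r r) (*-monoˡ-≤ r 2≤A))

  padded-bound : 2 ≤ A → ∀ r → A * padded r ≤ A * r + 6 * r
  padded-bound 2≤A r = begin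
    A * padded r                                ≤⟨ rounding-error fuel (r + slack r) ⟩
    A * (r + slack r) + 2 * (r + slack r)       ≡⟨ expand A r (slack r) ⟩
    A * r + (A * slack r + 2 * (r + slack r))   ≤⟨ +-monoʳ-≤ (A * r) (+-mono-≤ (A*slack≤2r r)
                                                      (*-monoʳ-≤ 2 (+-monoʳ-≤ r (slack≤ 2≤A r)))) ⟩
    A * r + (2 * r + 2 * (r + r))               ≡⟨ cong (A * r +_) (six r) ⟩
    A * r + 6 * r                               ∎
    where
    open ≤-Reasoning
    expand : ∀ a r x → a * (r + x) + 2 * (r + x) ≡ a * r + (a * x + 2 * (r + x))
    expand = solve-∀
    six : ∀ r → 2 * r + 2 * (r + r) ≡ 6 * r
    six = solve-∀

  padded-growth : ∀ r s H → 12 * suc H ≤ A → A * r ≤ s * (A + 12 * H) →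
                  A * padded r ≤ (A + 12 * suc H) * s
  padded-growth r s H 12H≤A IH = begin
    A * padded r                        ≤⟨ padded-bound 2≤A r ⟩
    A * r + 6 * r                       ≤⟨ +-mono-≤ IH (*-monoʳ-≤ 6 r≤2s) ⟩
    s * (A + 12 * H) + 6 * (2 * s)      ≡⟨ regroup s A H ⟩
    (A + 12 * suc H) * s                ∎
    where
    open ≤-Reasoning
    2≤A : 2 ≤ A
    2≤A = ≤-trans (s≤s (s≤s z≤n)) (≤-trans (≤-reflexive (sym (*-suc 12 H))) 12H≤A)
    r≤2s : r ≤ 2 * s
    r≤2s = *-cancelˡ-≤ A (begin
      A * r              ≤⟨ IH ⟩
      s * (A + 12 * H)   ≤⟨ *-monoʳ-≤ s (+-monoʳ-≤ A (≤-trans (*-monoʳ-≤ 12 (n≤1+n H)) 12H≤A)) ⟩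
      s * (A + A)        ≡⟨ double s A ⟩
      A * (2 * s)        ∎)
      where
      double : ∀ s a → s * (a + a) ≡ a * (2 * s)
      double = solve-∀
    regroup : ∀ s a h → s * (a + 12 * h) + 6 * (2 * s) ≡ (a + 12 * suc h) * s
    regroup = solve-∀

  span-bound : ∀ t H → size t ≤ 2 ^ H → 12 * H ≤ A → A * span t ≤ size t * (A + 12 * H)
  span-bound (node zero    f) H _      _     = ≤-trans (≤-reflexive (*-identityʳ A))
                                                      (≤-trans (m≤m+n A (12 * H)) (≤-reflexive (sym (+-identityʳ _))))
  span-bound (node (suc k) f) H size≤ 12H≤A = begin
    A * suc (lightTotal + span (f h))                          ≡⟨ expand A lightTotal (span (f h)) ⟩
    A + (A * lightTotal + A * span (f h))                      ≤⟨ +-mono-≤ (m≤m+n A (12 * H)) (+-mono-≤ light-part heavy-part) ⟩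
    C + (sumFin (suc k) (maskAt h (λ j → C * s j)) + C * s h)  ≡⟨ cong (C +_) (sumFin-maskAt (suc k) h (λ j → C * s j)) ⟩
    C + sumFin (suc k) (λ j → C * s j)                         ≡⟨ cong (C +_) (sumFin-scale (suc k) C s) ⟩
    C + C * S                                                  ≡⟨ cong (C +_) (*-comm C S) ⟩
    suc S * C                                                  ∎
    where
    open ≤-Reasoning
    open Children k f using (h; B; lightTotal; block-heavy; block-light)
    s : Fin (suc k) → ℕ
    s j = size (f j)
    S = sumFin (suc k) s
    C = A + 12 * H
    expand : ∀ a x y → a * suc (x + y) ≡ a + (a * x + a * y)
    expand = solve-∀

    heavy-part : A * span (f h) ≤ C * s h
    heavy-part = ≤-trans (span-bound (f h) H (≤-trans (≤-trans (term≤sumFin (suc k) s h) (n≤1+n S)) size≤) 12H≤A)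
                    (≤-reflexive (*-comm (s h) C))

    light : ∀ j → ¬ j ≡ h → A * padded (span (f j)) ≤ C * s j
    light j j≢h = by-height H size≤ 12H≤A
      where
      sj+sh≤S : s j + s h ≤ S
      sj+sh≤S = two-terms≤sumFin (suc k) s j h j≢h
      by-height : ∀ H → suc S ≤ 2 ^ H → 12 * H ≤ A → A * padded (span (f j)) ≤ (A + 12 * H) * s j
      by-height zero    S<1 _     = ⊥-elim (1+n≰n (≤-trans (s≤s 1≤S) S<1))
        where
        1≤S : 1 ≤ S
        1≤S = ≤-trans (size≥1 (f j)) (≤-trans (m≤m+n (s j) (s h)) sj+sh≤S)
      by-height (suc H) S<  12H≤A = padded-growth (span (f j)) (s j) H 12H≤A
        (span-bound (f j) H sj≤ (≤-trans (*-monoʳ-≤ 12 (n≤1+n H)) 12H≤A))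
        where
        -- a light child is at most as large as the heavy one, hence at most half
        sj≤ : s j ≤ 2 ^ H
        sj≤ = <⇒≤ (*-cancelˡ-< 2 (s j) (2 ^ H) (begin-strict
          2 * s j      ≡⟨ cong (s j +_) (+-identityʳ (s j)) ⟩
          s j + s j    ≤⟨ +-monoʳ-≤ (s j) (argmax-max k s j) ⟩
          s j + s h    ≤⟨ sj+sh≤S ⟩
          S            <⟨ S< ⟩
          2 ^ suc H    ∎))

    per-child : ∀ j → A * B j ≤ maskAt h (λ j → C * s j) j
    per-child j = by-cases (j ≟ᶠ h)
      where
      by-cases : Dec (j ≡ h) → A * B j ≤ maskAt h (λ j → C * s j) j
      by-cases (yes refl) = ≤-trans (≤-reflexive (trans (cong (A *_) block-heavy) (*-zeroʳ A))) z≤n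
      by-cases (no  j≢h)  = ≤-trans (≤-reflexive (cong (A *_) (block-light j j≢h)))
                              (≤-trans (light j j≢h) (≤-reflexive (sym (maskAt-there h j (λ j → C * s j) j≢h))))

    light-part : A * lightTotal ≤ sumFin (suc k) (maskAt h (λ j → C * s j))
    light-part = ≤-trans (≤-reflexive (sym (sumFin-scale (suc k) A B))) (sumFin-mono (suc k) per-child)

-- The labeling scheme.  The label of u is pos u in W binary digits followed
-- by nums (sub u), each number in w+1 digits; the decoder reads the two
-- positions and u's numbers and applies route.
module LabelingScheme (Δ W w A-1 fuel : ℕ)
  (fuel-fits : fuel < 2 ^ suc w) (A-fits : suc A-1 < 2 ^ suc w) (Δ-fits : Δ < 2 ^ suc w)
  (enough-fuel : 3 * 2 ^ W ≤ suc A-1 * 2 ^ fuel) where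
  open Bits
  open Rounding A-1
  open Layout A-1 fuel
  open Tables

  labelOf : {t : Tree} → Node t → List Bool
  labelOf u = toBits W (pos u) ++ encodeNums w (nums (sub u))

  decoder : List Bool → List Bool → ℕ
  decoder lu lw = route (fromBits (take W lw) ∸ fromBits (take W lu)) (decodeNums w (length lu) (drop W lu))

  scheme : Scheme
  scheme = record
    { encode = λ t → record { label = labelOf ; port = λ u → portOf (sub u) }
    ; decode = decoder
    }

  Fits : ℕ → Set
  Fits x = x < 2 ^ suc w

  demand-fuel : ∀ {k} h (r : Fin k → ℕ) j → r j ≤ 2 ^ W → demand h r j ≤ A * 2 ^ fuel
  demand-fuel h r j r≤ = begin
    demand h r j            ≤⟨ maskAt-≤ h j (λ j → r j + slack (r j)) ⟩
    r j + slack (r j)       ≤⟨ +-monoʳ-≤ (r j) slack≤2r ⟩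
    r j + 2 * r j           ≡⟨ triple (r j) ⟩
    3 * r j                 ≤⟨ *-monoʳ-≤ 3 r≤ ⟩
    3 * 2 ^ W               ≤⟨ enough-fuel ⟩
    A * 2 ^ fuel            ∎
    where
    open ≤-Reasoning
    open Sums using (maskAt-≤)
    slack≤2r : slack (r j) ≤ 2 * r j
    slack≤2r = ≤-trans (m≤m+n (slack (r j)) (A-1 * slack (r j))) (A*slack≤2r (r j))
    triple : ∀ x → x + 2 * x ≡ 3 * x
    triple = solve-∀

  exp-fits : ∀ r → Fits (exp fuel r)
  exp-fits r = ≤-<-trans (exp≤fuel fuel r) fuel-fits

  mant-fits : ∀ r → r ≤ A * 2 ^ fuel → Fits (mant fuel r)
  mant-fits r r≤ = ≤-<-trans (mant≤A fuel r r≤) A-fits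

  port-fits : ∀ t → deg t ≤ Δ → ∀ i → Fits (portOf t i)
  port-fits t deg≤ i = ≤-<-trans (≤-trans (proj₂ (CanonicalPorts.port-range (λ j → size (kid t j)) i)) deg≤) Δ-fits

  nums-fit : ∀ t → deg t ≤ Δ → span t ≤ 2 ^ W → All Fits (nums t)
  nums-fit t deg≤ span≤ = exp-fits (span t) ∷ mant-fits (span t) span-fuel ∷ table-fits t deg≤ span≤
    where
    span-fuel : span t ≤ A * 2 ^ fuel
    span-fuel = ≤-trans (≤-trans span≤ (m≤n*m (2 ^ W) 3)) enough-fuel
    table-fits : ∀ t → deg t ≤ Δ → span t ≤ 2 ^ W → All Fits (childTable t)
    table-fits (node zero    f) _ _ = []
    table-fits t@(node (suc k) f) deg≤ span≤ = port-fits t deg≤ _ ∷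
      table-entries< {2 ^ suc w} (suc k) (Children.E k f) (Children.M k f) (portOf t)
        (λ j → exp-fits _)
        (λ j → mant-fits _ (demand-fuel (Children.h k f) (Children.r k f) j (≤-trans (span-sub≤ (child j root)) span≤)))
        (port-fits t deg≤)

  length-nums : ∀ t → length (nums t) ≤ 3 + 3 * deg t
  length-nums (node zero    f) = s≤s (s≤s z≤n)
  length-nums (node (suc k) f) =
    ≤-reflexive (cong (3 +_) (length-table (suc k) (Children.E k f) (Children.M k f) (portOf (node (suc k) f))))

  length-label : ∀ {t} (u : Node t) → length (labelOf u) ≡ W + suc w * length (nums (sub u))
  length-label u = trans (length-++ (toBits W (pos u)))
                         (cong₂ _+_ (length-toBits W (pos u)) (length-encodeNums w (nums (sub u))))

  decoder-reads : ∀ {t} (u v : Node t) → MaxDeg Δ t → span t ≤ 2 ^ W →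
                  decoder (labelOf u) (labelOf v) ≡ route (pos v ∸ pos u) (nums (sub u))
  decoder-reads {t} u v maxDeg span≤ = cong₂ route
    (cong₂ _∸_ (read-prefix W (pos v) _ (≤-trans (pos<span v) span≤))
               (read-prefix W (pos u) _ (≤-trans (pos<span u) span≤)))
    (trans (cong (decodeNums w (length (labelOf u))) (drop-toBits W (pos u) _))
           (decode-encode w _ (nums (sub u)) enough (nums-fit (sub u) (maxDeg u) (≤-trans (span-sub≤ u) span≤))))
    where
    enough : length (nums (sub u)) ≤ length (labelOf u)
    enough = ≤-trans (m≤n*m _ (suc w)) (≤-trans (m≤n+m _ W) (≤-reflexive (sym (length-label u))))

  scheme-correct : ∀ t → MaxDeg Δ t → span t ≤ 2 ^ W →
    PortsValid (Scheme.encode scheme t) × Canonical (Scheme.encode scheme t)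
    × Correct scheme t × LabelsBounded (Scheme.encode scheme t) (W + suc w * (3 + 3 * Δ))
  scheme-correct t maxDeg span≤ = ports-valid , canonical , (towards , away) , bounded
    where
    ports-valid : PortsValid (Scheme.encode scheme t)
    ports-valid u = CanonicalPorts.port-range sizes , CanonicalPorts.port-injective sizes
      where sizes = λ j → size (kid (sub u) j)
    canonical : Canonical (Scheme.encode scheme t)
    canonical u = CanonicalPorts.port-canonical (λ j → size (kid (sub u) j))
    towards : ∀ (u v : Node t) i → Via u i v → decoder (labelOf u) (labelOf v) ≡ portOf (sub u) i
    towards u v i via = trans (decoder-reads u v maxDeg span≤) (route-via u v i via)
    away : ∀ (u v : Node t) → ¬ u ≡ v → (∀ i → ¬ Via u i v) → decoder (labelOf u) (labelOf v) ≡ 0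
    away u v u≢v not-below = trans (decoder-reads u v maxDeg span≤) (route-outside u v u≢v not-below)
    bounded : LabelsBounded (Scheme.encode scheme t) (W + suc w * (3 + 3 * Δ))
    bounded u = ≤-trans (≤-reflexive (length-label u))
      (+-monoʳ-≤ W (*-monoʳ-≤ (suc w) (≤-trans (length-nums (sub u)) (+-monoʳ-≤ 3 (*-monoʳ-≤ 3 (maxDeg u))))))

n<2^n : ∀ n → n < 2 ^ n
n<2^n zero    = s≤s z≤n
n<2^n (suc n) = begin-strict
  suc n              ≤⟨ n<2^n n ⟩
  2 ^ n              <⟨ m<m+n (2 ^ n) (≤-trans (m^n>0 2 n) (m≤m+n (2 ^ n) 0)) ⟩
  2 ^ n + (2 ^ n + 0) ∎
  where open ≤-Reasoning

n≤2^⌈log₂n⌉ : ∀ n → n ≤ 2 ^ ⌈log₂ n ⌉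
n≤2^⌈log₂n⌉ = <-rec (λ n → n ≤ 2 ^ ⌈log₂ n ⌉) step
  where
  open ≤-Reasoning
  step : ∀ n → (∀ {m} → m < n → m ≤ 2 ^ ⌈log₂ m ⌉) → n ≤ 2 ^ ⌈log₂ n ⌉
  step zero          _  = z≤n
  step (suc zero)    _  = s≤s z≤n
  step n@(suc (suc m)) IH = begin
    n                           ≤⟨ r≤2*⌈r/2⌉ n ⟩
    2 * ⌈ n /2⌉                 ≤⟨ *-monoʳ-≤ 2 (IH (⌈n/2⌉<n m)) ⟩
    2 * 2 ^ ⌈log₂ ⌈ n /2⌉ ⌉     ≡⟨ cong (λ e → 2 * 2 ^ e) (⌈log₂⌈n/2⌉⌉≡⌈log₂n⌉∸1 n) ⟩
    2 ^ suc (⌈log₂ n ⌉ ∸ 1)     ≡⟨ cong (2 ^_) (trans (+-comm 1 _) (m∸n+n≡m 1≤⌈log₂n⌉)) ⟩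
    2 ^ ⌈log₂ n ⌉               ∎
    where
    1≤⌈log₂n⌉ : 1 ≤ ⌈log₂ n ⌉
    1≤⌈log₂n⌉ = ⌈log₂⌉-mono-≤ {2} {n} (s≤s (s≤s z≤n))

-- The parameters for trees with n nodes, where lg = ⌈log₂ n⌉ and
-- L = ⌈log₂ lg⌉: positions take W = lg + 1 digits, the mantissa bound
-- A = 1 + 16 · 2^L ≥ 12 lg keeps spans below 2n, and every stored number
-- fits in L + 5 + Δ digits.
module Parameters (Δ n : ℕ) where
  lg L P W w A-1 fuel : ℕ
  lg   = ⌈log₂ n ⌉
  L    = ⌈log₂ lg ⌉
  P    = 2 ^ L
  W    = suc lg
  w    = L + 4 + Δ
  A-1  = 16 * P
  fuel = W + 2

  open Rounding A-1 using (A)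

  lg≤P : lg ≤ P
  lg≤P = n≤2^⌈log₂n⌉ lg

  fits-below : ∀ x → x ≤ 16 * P → suc x < 2 ^ suc w
  fits-below x x≤ = begin
    2 + x              ≤⟨ +-monoʳ-≤ 2 x≤ ⟩
    2 + 16 * P         ≤⟨ +-monoˡ-≤ (16 * P) (≤-trans (s≤s (s≤s z≤n)) (*-monoʳ-≤ 16 (m^n>0 2 L))) ⟩
    16 * P + 16 * P    ≡⟨ double P ⟩
    P * 2 ^ 5          ≡⟨ sym (^-distribˡ-+-* 2 L 5) ⟩
    2 ^ (L + 5)        ≡⟨ cong (2 ^_) (+-suc L 4) ⟩
    2 ^ suc (L + 4)    ≤⟨ ^-monoʳ-≤ 2 (s≤s (m≤m+n (L + 4) Δ)) ⟩
    2 ^ suc w          ∎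
    where
    open ≤-Reasoning
    double : ∀ p → 16 * p + 16 * p ≡ p * 32
    double = solve-∀

  fuel-fits : fuel < 2 ^ suc w
  fuel-fits = fits-below (lg + 2) (+-mono-≤ lg≤P (≤-trans (s≤s (s≤s z≤n)) (*-monoʳ-≤ 15 (m^n>0 2 L))))

  A-fits : A < 2 ^ suc w
  A-fits = fits-below (16 * P) ≤-refl

  Δ-fits : Δ < 2 ^ suc w
  Δ-fits = <-≤-trans (n<2^n Δ) (^-monoʳ-≤ 2 (≤-trans (m≤n+m Δ (L + 4)) (n≤1+n w)))

  enough-fuel : 3 * 2 ^ W ≤ A * 2 ^ fuel
  enough-fuel = begin
    3 * 2 ^ W          ≤⟨ *-monoˡ-≤ (2 ^ W) (n≤1+n 3) ⟩
    4 * 2 ^ W          ≡⟨ *-comm 4 (2 ^ W) ⟩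
    2 ^ W * 2 ^ 2      ≡⟨ sym (^-distribˡ-+-* 2 W 2) ⟩
    2 ^ fuel           ≤⟨ m≤n*m (2 ^ fuel) A ⟩
    A * 2 ^ fuel       ∎
    where open ≤-Reasoning

  12lg≤A : 12 * lg ≤ A
  12lg≤A = ≤-trans (*-monoʳ-≤ 12 lg≤P) (≤-trans (*-monoˡ-≤ P (m≤m+n 12 4)) (n≤1+n (16 * P)))

  span≤ : ∀ t → size t ≡ n → Layout.span A-1 fuel t ≤ 2 ^ W
  span≤ t size≡n = *-cancelˡ-≤ A (begin
    A * Layout.span A-1 fuel t   ≤⟨ SpanBound.span-bound A-1 fuel t lg size≤ 12lg≤A ⟩
    size t * (A + 12 * lg)       ≤⟨ *-mono-≤ size≤ (+-monoʳ-≤ A 12lg≤A) ⟩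
    2 ^ lg * (A + A)             ≡⟨ regroup (2 ^ lg) A ⟩
    A * 2 ^ W                    ∎)
    where
    open ≤-Reasoning
    size≤ : size t ≤ 2 ^ lg
    size≤ = subst (_≤ 2 ^ lg) (sym size≡n) (n≤2^⌈log₂n⌉ n)
    regroup : ∀ x a → x * (a + a) ≡ a * (2 * x)
    regroup = solve-∀

  label-length : 4 ≤ n → W + suc w * (3 + 3 * Δ) ≤ lg + (1 + (6 + Δ) * (3 + 3 * Δ)) * L
  label-length 4≤n = bound L 1≤L
    where
    1≤L : 1 ≤ L
    1≤L = ⌈log₂⌉-mono-≤ {2} {lg} (⌈log₂⌉-mono-≤ {4} {n} 4≤n)
    bound : ∀ l → 1 ≤ l → W + suc (l + 4 + Δ) * (3 + 3 * Δ) ≤ lg + (1 + (6 + Δ) * (3 + 3 * Δ)) * l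
    bound (suc l) _ = ≤-trans (m≤m+n _ (l + l * ((5 + Δ) * (3 + 3 * Δ)))) (≤-reflexive (expand lg l Δ))
      where
      expand : ∀ g l d → suc g + suc (suc l + 4 + d) * (3 + 3 * d) + (l + l * ((5 + d) * (3 + 3 * d)))
                         ≡ g + (1 + (6 + d) * (3 + 3 * d)) * suc l
      expand = solve-∀

  open LabelingScheme Δ W w A-1 fuel fuel-fits A-fits Δ-fits enough-fuel public
    using (scheme; scheme-correct)

LabelsBounded-weaken : ∀ {t} (L : Labeling t) {b b′} → b ≤ b′ → LabelsBounded L b → LabelsBounded L b′
LabelsBounded-weaken L b≤b′ bounded u = ≤-trans (bounded u) b≤b′

mainTheorem3 : (Δ : ℕ) → Σ[ c ∈ ℕ ] Σ[ n₀ ∈ ℕ ] ((n : ℕ) → n₀ ≤ n →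
    Σ[ S ∈ Scheme ] CanonicalRoutingScheme Δ n S (⌈log₂ n ⌉ + c * ⌈log₂ ⌈log₂ n ⌉ ⌉))
mainTheorem3 Δ = 1 + (6 + Δ) * (3 + 3 * Δ) , 4 , λ n 4≤n → scheme Δ n , λ t size≡n maxDeg →
  let ports , canonical , correct , bounded = scheme-correct Δ n t maxDeg (span≤ Δ n t size≡n)
  in  ports , canonical , correct ,
      LabelsBounded-weaken (Scheme.encode (scheme Δ n) t) (label-length Δ n 4≤n) bounded
  where open Parameters
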